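{- Let $\mathbf{A}=(a_{ij})$ be an $m\times n$ binary array (each entry is $0$ or $1$) with row set $R$ and column set $C$, and assume no row and no column of $\mathbf{A}$ consists only of zeros. For $X\subset R$ and $Y\subset C$ define \[ V(X)=\sum_{i\in X}\sum_{j\in C}a_{ij},\qquad V(Y)=\sum_{i\in R}\sum_{j\in Y}a_{ij},\qquad a(X,Y)=\sum_{i\in X}\sum_{j\in Y}a_{ij}, \] and for nonempty $X\subset R$, $Y\subset C$ define $d(X,Y)=\dfrac{a(X,Y)}{V(X)\,V(Y)}$. Let $0<\delta<\frac14$, let $X\subset R$ and $Y\subset C$ be nonempty, and let $X^*\subset X$, $Y^*\subset Y$ satisfy $\frac{V(X^*)}{V(X)}\ge 1-\delta$ and $\frac{V(Y^*)}{V(Y)}\ge 1-\delta$. Then \[ |d(X,Y)-d(X^*,Y^*)|\le 4\delta . \]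
   Context: Since no row or column is identically zero, $V(X),V(Y)\ge 1$ for every nonempty $X\subset R$, $Y\subset C$.
   Formalization: The parameter δ ranges only over the rationals in the interval from 0 to 1/4. -}

module Defs where

open import Data.Bool using (Bool; true; false)
open import Data.Nat using (ℕ; zero; suc; _+_; _*_)
open import Data.Fin using (Fin)
import Data.Fin as F
open import Data.Fin.Subset using (Subset)
open import Data.Vec using (lookup)
open import Data.Integer using (+_)
open import Data.Rational using (ℚ; _/_; 0ℚ)

bit : Bool → ℕ
bit true  = 1
bit false = 0

sumFin : (k : ℕ) → (Fin k → ℕ) → ℕ
sumFin zero    f = 0
sumFin (suc k) f = f F.zero + sumFin k (λ i → f (F.suc i))

ind : ∀ {k} → Subset k → Fin k → ℕ
ind S i = bit (lookup S i)

Array : ℕ → ℕ → Set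
Array m n = Fin m → Fin n → Bool

module _ {m n : ℕ} (A : Array m n) where
  a : Subset m → Subset n → ℕ
  a X Y = sumFin m (λ i → ind X i * sumFin n (λ j → ind Y j * bit (A i j)))

  VR : Subset m → ℕ
  VR X = sumFin m (λ i → ind X i * sumFin n (λ j → bit (A i j)))

  VC : Subset n → ℕ
  VC Y = sumFin m (λ i → sumFin n (λ j → ind Y j * bit (A i j)))

-- ratio of naturals as a rational; convention p/0 = 0 (never used
-- with a zero denominator under the theorem's hypotheses)
_÷ℕ_ : ℕ → ℕ → ℚ
p ÷ℕ zero  = 0ℚ
p ÷ℕ suc q = (+ p) / suc q

module _ {m n : ℕ} (A : Array m n) where
  d : Subset m → Subset n → ℚ
  d X Y = a A X Y ÷ℕ (VR A X * VC A Y)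

module Submission where

-- Stability of the density d(X,Y) = a(X,Y) / (V(X) V(Y)) under passing to large
-- subsets X* ⊆ X, Y* ⊆ Y.  Write a = a(X,Y), a′ = a(X*,Y*), V = V(X), V′ = V(X*),
-- W = V(Y), W′ = V(Y*).
--
-- Counting (FiniteSums, Indicators, ArrayCounts): every count is a double sum
-- over the array, so a′ ≤ a, a′ ≤ V′, V′ ≤ V, W′ ≤ W, V, W ≥ 1 and the
-- inclusion–exclusion bound a − a′ ≤ (V − V′) + (W − W′) are entrywise facts.
-- Arithmetic (Deficiency), with δ = p/Q and hypotheses cleared to Q V ≤ Q V′ + p V:
--   d(X,Y) − d(X*,Y*) ≤ (a − a′)/(VW) ≤ δ (V + W)/(VW) ≤ 2δ,
--   d(X*,Y*) − d(X,Y) ≤ a′ (VW − V′W′)/(V′W′ · VW) ≤ 1 − (1 − δ)² ≤ 2δ,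
-- so the bound 4δ holds with room to spare; δ < 1/4 only makes V′, W′ nonzero.

open import Defs using (Array; _÷ℕ_)
open import Data.Nat using (ℕ)

module FiniteSums where

  open import Defs using (sumFin)
  open import Data.Nat using (ℕ; zero; suc; _+_; _*_; _≤_; z≤n)
  open import Data.Nat.Properties using (+-mono-≤; m≤m+n; m≤n+m; ≤-trans; +-*-semiring)
  open import Data.Fin using (Fin; zero; suc)
  open import Algebra.Properties.Semiring.Sum +-*-semiring using (sum; ∑-distrib-+; *-distribˡ-sum)
  open import Relation.Binary.PropositionalEquality using (_≡_; refl; sym; trans; cong; cong₂)

  -- sumFin is the library's finite sum over ℕ; this lets us reuse its algebra.
  sumFin≡sum : ∀ k (f : Fin k → ℕ) → sumFin k f ≡ sum f
  sumFin≡sum zero    f = refl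
  sumFin≡sum (suc k) f = cong (f zero +_) (sumFin≡sum k (λ i → f (suc i)))

  sumFin-cong : ∀ k {f g : Fin k → ℕ} → (∀ i → f i ≡ g i) → sumFin k f ≡ sumFin k g
  sumFin-cong zero    f≗g = refl
  sumFin-cong (suc k) f≗g = cong₂ _+_ (f≗g zero) (sumFin-cong k (λ i → f≗g (suc i)))

  sumFin-mono : ∀ k {f g : Fin k → ℕ} → (∀ i → f i ≤ g i) → sumFin k f ≤ sumFin k g
  sumFin-mono zero    f≤g = z≤n
  sumFin-mono (suc k) f≤g = +-mono-≤ (f≤g zero) (sumFin-mono k (λ i → f≤g (suc i)))

  sumFin-term : ∀ k (f : Fin k → ℕ) i → f i ≤ sumFin k f
  sumFin-term (suc k) f zero    = m≤m+n (f zero) _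
  sumFin-term (suc k) f (suc i) = ≤-trans (sumFin-term k (λ i → f (suc i)) i) (m≤n+m _ (f zero))

  sumFin-+ : ∀ k (f g : Fin k → ℕ) → sumFin k f + sumFin k g ≡ sumFin k (λ i → f i + g i)
  sumFin-+ k f g = trans (cong₂ _+_ (sumFin≡sum k f) (sumFin≡sum k g))
                         (trans (sym (∑-distrib-+ f g)) (sym (sumFin≡sum k (λ i → f i + g i))))

  sumFin-*ˡ : ∀ k c (f : Fin k → ℕ) → c * sumFin k f ≡ sumFin k (λ i → c * f i)
  sumFin-*ˡ k c f = trans (cong (c *_) (sumFin≡sum k f))
                          (trans (*-distribˡ-sum c f) (sym (sumFin≡sum k (λ i → c * f i))))

  doubleSum : ∀ {m n} → (Fin m → Fin n → ℕ) → ℕ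
  doubleSum {m} {n} f = sumFin m (λ i → sumFin n (f i))

  doubleSum-mono : ∀ {m n} {f g : Fin m → Fin n → ℕ} →
    (∀ i j → f i j ≤ g i j) → doubleSum f ≤ doubleSum g
  doubleSum-mono {m} {n} f≤g = sumFin-mono m (λ i → sumFin-mono n (f≤g i))

  doubleSum-entry : ∀ {m n} (f : Fin m → Fin n → ℕ) i j → f i j ≤ doubleSum f
  doubleSum-entry {m} {n} f i j = ≤-trans (sumFin-term n (f i) j) (sumFin-term m (λ i → sumFin n (f i)) i)

  doubleSum-+ : ∀ {m n} (f g : Fin m → Fin n → ℕ) →
    doubleSum f + doubleSum g ≡ doubleSum (λ i j → f i j + g i j)
  doubleSum-+ {m} {n} f g =
    trans (sumFin-+ m _ _) (sumFin-cong m (λ i → sumFin-+ n (f i) (g i)))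


module Indicators where

  open import Defs using (bit; ind)
  open import Data.Bool using (true; false)
  open import Data.Nat using (_+_; _*_; _≤_; z≤n; s≤s)
  open import Data.Nat.Properties using (≤-refl; ≤-reflexive; +-identityʳ)
  open import Data.Fin.Subset using (Subset; _⊆_)
  open import Data.Vec using (lookup)
  open import Data.Vec.Properties using ([]=⇒lookup; lookup⇒[]=)

  bit*≤ : ∀ x e → bit x * e ≤ e
  bit*≤ true  e = ≤-reflexive (+-identityʳ e)
  bit*≤ false e = z≤n

  ind-⊆ : ∀ {k} {S T : Subset k} → S ⊆ T → ∀ i → ind S i ≤ ind T i
  ind-⊆ {S = S} {T} S⊆T i with lookup S i in S[i]
  ... | false = z≤n
  ... | true rewrite []=⇒lookup (S⊆T (lookup⇒[]= i S S[i])) = ≤-refl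

  -- Entrywise inclusion–exclusion: for bits x′ ≤ x and y′ ≤ y,
  -- x y − x′ y′ ≤ (x − x′) + (y − y′).
  bit-inclusion-exclusion : ∀ x x′ y y′ → bit x′ ≤ bit x → bit y′ ≤ bit y →
    bit x * bit y + bit x′ + bit y′ ≤ bit x′ * bit y′ + bit x + bit y
  bit-inclusion-exclusion false true  _     _     ()
  bit-inclusion-exclusion _     _     false true  _  ()
  bit-inclusion-exclusion true  true  true  true  _  _ = ≤-refl
  bit-inclusion-exclusion true  true  true  false _  _ = ≤-refl
  bit-inclusion-exclusion true  true  false false _  _ = ≤-refl
  bit-inclusion-exclusion true  false true  true  _  _ = ≤-refl
  bit-inclusion-exclusion true  false true  false _  _ = s≤s z≤n
  bit-inclusion-exclusion true  false false false _  _ = z≤n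
  bit-inclusion-exclusion false false true  true  _  _ = ≤-refl
  bit-inclusion-exclusion false false true  false _  _ = z≤n
  bit-inclusion-exclusion false false false false _  _ = z≤n


module ArrayCounts {m n : ℕ} (A : Array m n) where

  open import Defs
  open FiniteSums
  open Indicators
  open import Data.Bool using (true)
  open import Data.Nat using (ℕ; _+_; _*_; _≤_)
  open import Data.Nat.Properties using (*-monoʳ-≤; *-monoˡ-≤; *-mono-≤; module ≤-Reasoning)
  open import Data.Nat.Tactic.RingSolver using (solve-∀)
  open import Data.Fin using (Fin)
  open import Data.Fin.Subset using (Subset; _⊆_; Nonempty)
  open import Data.Vec using (lookup)
  open import Data.Vec.Properties using ([]=⇒lookup)
  open import Data.Product using (∃; _,_)
  open import Relation.Binary.PropositionalEquality using (_≡_; sym; trans; cong; cong₂; subst₂)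
  open ≤-Reasoning

  entry : Fin m → Fin n → ℕ
  entry i j = bit (A i j)

  a-doubleSum : ∀ X Y → a A X Y ≡ doubleSum (λ i j → ind X i * (ind Y j * entry i j))
  a-doubleSum X Y = sumFin-cong m (λ i → sumFin-*ˡ n (ind X i) _)

  VR-doubleSum : ∀ X → VR A X ≡ doubleSum (λ i j → ind X i * entry i j)
  VR-doubleSum X = sumFin-cong m (λ i → sumFin-*ˡ n (ind X i) _)

  a≤VR : ∀ X Y → a A X Y ≤ VR A X
  a≤VR X Y = subst₂ _≤_ (sym (a-doubleSum X Y)) (sym (VR-doubleSum X))
    (doubleSum-mono (λ i j → *-monoʳ-≤ (ind X i) (bit*≤ (lookup Y j) (entry i j))))

  a-mono : ∀ {X Xs Y Ys} → Xs ⊆ X → Ys ⊆ Y → a A Xs Ys ≤ a A X Y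
  a-mono {X} {Xs} {Y} {Ys} Xs⊆X Ys⊆Y = subst₂ _≤_ (sym (a-doubleSum Xs Ys)) (sym (a-doubleSum X Y))
    (doubleSum-mono (λ i j → *-mono-≤ (ind-⊆ Xs⊆X i) (*-monoˡ-≤ (entry i j) (ind-⊆ Ys⊆Y j))))

  VR-mono : ∀ {X Xs} → Xs ⊆ X → VR A Xs ≤ VR A X
  VR-mono {X} {Xs} Xs⊆X = subst₂ _≤_ (sym (VR-doubleSum Xs)) (sym (VR-doubleSum X))
    (doubleSum-mono (λ i j → *-monoˡ-≤ (entry i j) (ind-⊆ Xs⊆X i)))

  VC-mono : ∀ {Y Ys} → Ys ⊆ Y → VC A Ys ≤ VC A Y
  VC-mono Ys⊆Y = doubleSum-mono (λ i j → *-monoˡ-≤ (entry i j) (ind-⊆ Ys⊆Y j))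

  VR-positive : (∀ i → ∃ λ j → A i j ≡ true) → ∀ {X} → Nonempty X → 1 ≤ VR A X
  VR-positive rows {X} (i , i∈X) with rows i
  ... | j , Aij = begin
    1                         ≡⟨ cong₂ (λ x y → bit x * bit y) ([]=⇒lookup i∈X) Aij ⟨
    ind X i * entry i j       ≤⟨ doubleSum-entry (λ i j → ind X i * entry i j) i j ⟩
    doubleSum (λ i j → ind X i * entry i j) ≡⟨ VR-doubleSum X ⟨
    VR A X                    ∎

  VC-positive : (∀ j → ∃ λ i → A i j ≡ true) → ∀ {Y} → Nonempty Y → 1 ≤ VC A Y
  VC-positive cols {Y} (j , j∈Y) with cols j
  ... | i , Aij = begin
    1                         ≡⟨ cong₂ (λ y x → bit y * bit x) ([]=⇒lookup j∈Y) Aij ⟨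
    ind Y j * entry i j       ≤⟨ doubleSum-entry (λ i j → ind Y j * entry i j) i j ⟩
    VC A Y                    ∎

  -- a(X,Y) − a(X*,Y*) ≤ (V(X) − V(X*)) + (V(Y) − V(Y*)), summed entrywise.
  inclusion-exclusion : ∀ {X Xs Y Ys} → Xs ⊆ X → Ys ⊆ Y →
    a A X Y + VR A Xs + VC A Ys ≤ a A Xs Ys + VR A X + VC A Y
  inclusion-exclusion {X} {Xs} {Y} {Ys} Xs⊆X Ys⊆Y = begin
    a A X Y + VR A Xs + VC A Ys
      ≡⟨ cong₂ (λ u v → u + v + VC A Ys) (a-doubleSum X Y) (VR-doubleSum Xs) ⟩
    doubleSum (weighted X Y) + doubleSum (rowWeighted Xs) + doubleSum (colWeighted Ys)
      ≡⟨ sum₃ (weighted X Y) (rowWeighted Xs) (colWeighted Ys) ⟩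
    doubleSum (λ i j → weighted X Y i j + rowWeighted Xs i j + colWeighted Ys i j)
      ≤⟨ doubleSum-mono entrywise ⟩
    doubleSum (λ i j → weighted Xs Ys i j + rowWeighted X i j + colWeighted Y i j)
      ≡⟨ sum₃ (weighted Xs Ys) (rowWeighted X) (colWeighted Y) ⟨
    doubleSum (weighted Xs Ys) + doubleSum (rowWeighted X) + doubleSum (colWeighted Y)
      ≡⟨ cong₂ (λ u v → u + v + VC A Y) (a-doubleSum Xs Ys) (VR-doubleSum X) ⟨
    a A Xs Ys + VR A X + VC A Y ∎
    where
    weighted : Subset m → Subset n → Fin m → Fin n → ℕ
    weighted X Y i j = ind X i * (ind Y j * entry i j)
    rowWeighted : Subset m → Fin m → Fin n → ℕ
    rowWeighted X i j = ind X i * entry i j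
    colWeighted : Subset n → Fin m → Fin n → ℕ
    colWeighted Y i j = ind Y j * entry i j

    sum₃ : ∀ f g h → doubleSum f + doubleSum g + doubleSum h ≡ doubleSum (λ i j → f i j + g i j + h i j)
    sum₃ f g h = trans (cong (_+ doubleSum h) (doubleSum-+ f g)) (doubleSum-+ _ h)

    factor : ∀ x y x′ y′ e → x * (y * e) + x′ * e + y′ * e ≡ (x * y + x′ + y′) * e
    factor = solve-∀

    entrywise : ∀ i j → weighted X Y i j + rowWeighted Xs i j + colWeighted Ys i j
                      ≤ weighted Xs Ys i j + rowWeighted X i j + colWeighted Y i j
    entrywise i j = subst₂ _≤_ (sym (factor (ind X i) (ind Y j) (ind Xs i) (ind Ys j) (entry i j)))
                               (sym (factor (ind Xs i) (ind Ys j) (ind X i) (ind Y j) (entry i j)))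
      (*-monoˡ-≤ (entry i j) (bit-inclusion-exclusion (lookup X i) (lookup Xs i) (lookup Y j) (lookup Ys j)
        (ind-⊆ Xs⊆X i) (ind-⊆ Ys⊆Y j)))


module Deficiency where

  -- Natural-number arithmetic with δ = p/Q; a hypothesis V′/V ≥ 1 − δ is used in
  -- the cleared form  Q V ≤ Q V′ + p V.

  open import Data.Nat using (zero; suc; _+_; _*_; _≤_; _<_; z≤n; s≤s)
  open import Data.Nat.Properties
  open import Data.Nat.Tactic.RingSolver using (solve)
  open import Data.List using ([]; _∷_)
  open import Relation.Binary.PropositionalEquality using (cong; subst)
  open import Relation.Nullary using (contradiction)
  open ≤-Reasoning

  positive-part : ∀ {Q p V V′} → p < Q → 1 ≤ V → Q * V ≤ Q * V′ + p * V → 1 ≤ V′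
  positive-part {Q} {p} {V} {zero} p<Q (s≤s z≤n) h =
    contradiction (*-cancelʳ-≤ Q p V (subst (Q * V ≤_) (cong (_+ p * V) (*-zeroʳ Q)) h)) (<⇒≱ p<Q)
  positive-part {V′ = suc _} _ _ _ = s≤s z≤n

  deficiency-bound : ∀ {Q p a a′ V V′ W W′} → a + V′ + W′ ≤ a′ + V + W →
    Q * V ≤ Q * V′ + p * V → Q * W ≤ Q * W′ + p * W → Q * a ≤ Q * a′ + p * (V + W)
  deficiency-bound {Q} {p} {a} {a′} {V} {V′} {W} {W′} ie hV hW =
    +-cancelʳ-≤ (Q * (V′ + W′)) _ _ (begin
      Q * a + Q * (V′ + W′)                       ≡⟨ solve (Q ∷ a ∷ V′ ∷ W′ ∷ []) ⟩
      Q * (a + V′ + W′)                           ≤⟨ *-monoʳ-≤ Q ie ⟩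
      Q * (a′ + V + W)                            ≡⟨ solve (Q ∷ a′ ∷ V ∷ W ∷ []) ⟩
      Q * a′ + Q * V + Q * W                      ≤⟨ +-mono-≤ (+-monoʳ-≤ (Q * a′) hV) hW ⟩
      Q * a′ + (Q * V′ + p * V) + (Q * W′ + p * W) ≡⟨ solve (Q ∷ p ∷ a′ ∷ V ∷ V′ ∷ W ∷ W′ ∷ []) ⟩
      Q * a′ + p * (V + W) + Q * (V′ + W′)        ∎)

  -- (1 − δ)² ≥ 1 − 2δ:  if V′ ≥ (1 − δ) V and W′ ≥ (1 − δ) W then V′W′ ≥ (1 − 2δ) VW.
  product-deficiency : ∀ {Q p V V′ W W′} → V′ ≤ V →
    Q * V ≤ Q * V′ + p * V → Q * W ≤ Q * W′ + p * W → Q * (V * W) ≤ Q * (V′ * W′) + 2 * p * (V * W)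
  product-deficiency {Q} {p} {V} {V′} {W} {W′} V′≤V hV hW = begin
    Q * (V * W)                               ≡⟨ solve (Q ∷ V ∷ W ∷ []) ⟩
    Q * V * W                                 ≤⟨ *-monoˡ-≤ W hV ⟩
    (Q * V′ + p * V) * W                      ≡⟨ solve (Q ∷ p ∷ V ∷ V′ ∷ W ∷ []) ⟩
    V′ * (Q * W) + p * (V * W)                ≤⟨ +-monoˡ-≤ (p * (V * W)) (*-monoʳ-≤ V′ hW) ⟩
    V′ * (Q * W′ + p * W) + p * (V * W)       ≡⟨ solve (Q ∷ p ∷ V ∷ V′ ∷ W ∷ W′ ∷ []) ⟩
    Q * (V′ * W′) + p * (V′ * W) + p * (V * W)
      ≤⟨ +-monoˡ-≤ (p * (V * W)) (+-monoʳ-≤ (Q * (V′ * W′)) (*-monoʳ-≤ p (*-monoˡ-≤ W V′≤V))) ⟩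
    Q * (V′ * W′) + p * (V * W) + p * (V * W) ≡⟨ solve (Q ∷ p ∷ V ∷ V′ ∷ W ∷ W′ ∷ []) ⟩
    Q * (V′ * W′) + 2 * p * (V * W)           ∎

  sum≤2*product : ∀ {V W} → 1 ≤ V → 1 ≤ W → V + W ≤ 2 * (V * W)
  sum≤2*product {V@(suc _)} {W@(suc _)} _ _ = begin
    V + W         ≤⟨ +-mono-≤ (m≤m*n V W) (m≤n*m W V) ⟩
    V * W + V * W ≡⟨ cong (V * W +_) (+-identityʳ (V * W)) ⟨
    2 * (V * W)   ∎

  -- a/B ≤ a′/E + 2δ  when E ≤ B and a − a′ ≤ δ S with S ≤ 2B.
  upper-bound : ∀ {Q p a a′ B E S} → E ≤ B → S ≤ 2 * B →
    Q * a ≤ Q * a′ + p * S → Q * a * E ≤ Q * a′ * B + 2 * p * B * E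
  upper-bound {Q} {p} {a} {a′} {B} {E} {S} E≤B S≤2B h = begin
    Q * a * E                    ≤⟨ *-monoˡ-≤ E h ⟩
    (Q * a′ + p * S) * E         ≡⟨ solve (Q ∷ p ∷ a′ ∷ S ∷ E ∷ []) ⟩
    Q * a′ * E + p * S * E       ≤⟨ +-mono-≤ (*-monoʳ-≤ (Q * a′) E≤B) (*-monoˡ-≤ E (*-monoʳ-≤ p S≤2B)) ⟩
    Q * a′ * B + p * (2 * B) * E ≡⟨ solve (Q ∷ p ∷ a′ ∷ B ∷ E ∷ []) ⟩
    Q * a′ * B + 2 * p * B * E   ∎

  -- a′/E ≤ a/B + 2δ  when a′ ≤ a, a′ ≤ E and E ≥ (1 − 2δ) B.
  lower-bound : ∀ {Q p a a′ B E} → a′ ≤ a → a′ ≤ E →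
    Q * B ≤ Q * E + 2 * p * B → Q * a′ * B ≤ Q * a * E + 2 * p * E * B
  lower-bound {Q} {p} {a} {a′} {B} {E} a′≤a a′≤E h = begin
    Q * a′ * B                   ≡⟨ solve (Q ∷ a′ ∷ B ∷ []) ⟩
    a′ * (Q * B)                 ≤⟨ *-monoʳ-≤ a′ h ⟩
    a′ * (Q * E + 2 * p * B)     ≡⟨ solve (Q ∷ p ∷ a′ ∷ B ∷ E ∷ []) ⟩
    Q * a′ * E + 2 * p * a′ * B  ≤⟨ +-mono-≤ (*-monoˡ-≤ E (*-monoʳ-≤ Q a′≤a)) (*-monoˡ-≤ B (*-monoʳ-≤ (2 * p) a′≤E)) ⟩
    Q * a * E + 2 * p * E * B    ∎

  slack-2≤4 : ∀ {x y p D₁ D₂} → x ≤ y + 2 * p * D₁ * D₂ → x ≤ y + 4 * p * D₁ * D₂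
  slack-2≤4 {y = y} {p} {D₁} {D₂} h =
    ≤-trans h (+-monoʳ-≤ y (*-monoˡ-≤ D₂ (*-monoˡ-≤ D₁ (*-monoˡ-≤ p {2} {4} (s≤s (s≤s z≤n))))))


module NaturalFractions where

  -- Rationals of the form n ÷ℕ D with D ≠ 0, compared by cross-multiplication.
  -- Each identity is checked in ℚᵘ, where numerators and denominators compute.

  open import Data.Nat as ℕ using (suc)
  import Data.Nat.Properties as ℕ
  open import Data.Nat.Tactic.RingSolver using (solve-∀)
  open import Data.Nat.Coprimality using (Coprime)
  open import Data.Integer as ℤ using (+_)
  import Data.Integer.Properties as ℤ
  open import Data.Rational using (mkℚ; _/_; _<_; _≤_; _≥_; _+_; _-_; _*_; -_; ∣_∣; 1ℚ; toℚᵘ; *<*)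
  open import Data.Rational.Properties
  open import Data.Rational.Unnormalised as ℚᵘ using (mkℚᵘ; *≤*)
  import Data.Rational.Unnormalised.Properties as ℚᵘ
  open import Algebra.Properties.AbelianGroup +-0-abelianGroup using (⁻¹-anti-homo‿-)
  open import Algebra.Properties.Group +-0-group using (//-rightDividesˡ; //-rightDividesʳ)
  open import Data.Sum using (inj₁; inj₂)
  open import Function.Bundles using (_⇔_; mk⇔; Equivalence)
  open import Relation.Binary.PropositionalEquality

  toℚᵘ-÷ℕ : ∀ n d → toℚᵘ (n ÷ℕ suc d) ℚᵘ.≃ mkℚᵘ (+ n) d
  toℚᵘ-÷ℕ n d = toℚᵘ-fromℚᵘ (mkℚᵘ (+ n) d)

  ÷ℕ-+ : ∀ m c n d → m ÷ℕ suc c + n ÷ℕ suc d ≡ (m ℕ.* suc d ℕ.+ n ℕ.* suc c) ÷ℕ (suc c ℕ.* suc d)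
  ÷ℕ-+ m c n d = toℚᵘ-injective (begin
    toℚᵘ (m ÷ℕ suc c + n ÷ℕ suc d)             ≈⟨ toℚᵘ-homo-+ (m ÷ℕ suc c) (n ÷ℕ suc d) ⟩
    toℚᵘ (m ÷ℕ suc c) ℚᵘ.+ toℚᵘ (n ÷ℕ suc d)   ≈⟨ ℚᵘ.+-cong (toℚᵘ-÷ℕ m c) (toℚᵘ-÷ℕ n d) ⟩
    mkℚᵘ (+ m ℤ.* + suc d ℤ.+ + n ℤ.* + suc c) _ ≡⟨ cong (λ z → mkℚᵘ z _) numerator ⟩
    mkℚᵘ (+ (m ℕ.* suc d ℕ.+ n ℕ.* suc c)) _   ≈⟨ toℚᵘ-÷ℕ (m ℕ.* suc d ℕ.+ n ℕ.* suc c) _ ⟨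
    toℚᵘ ((m ℕ.* suc d ℕ.+ n ℕ.* suc c) ÷ℕ (suc c ℕ.* suc d)) ∎)
    where
    open ℚᵘ.≃-Reasoning
    numerator : + m ℤ.* + suc d ℤ.+ + n ℤ.* + suc c ≡ + (m ℕ.* suc d ℕ.+ n ℕ.* suc c)
    numerator = trans (cong₂ ℤ._+_ (sym (ℤ.pos-* m (suc d))) (sym (ℤ.pos-* n (suc c))))
                      (sym (ℤ.pos-+ (m ℕ.* suc d) (n ℕ.* suc c)))

  ÷ℕ-* : ∀ m c n d → m ÷ℕ suc c * n ÷ℕ suc d ≡ (m ℕ.* n) ÷ℕ (suc c ℕ.* suc d)
  ÷ℕ-* m c n d = toℚᵘ-injective (begin
    toℚᵘ (m ÷ℕ suc c * n ÷ℕ suc d)             ≈⟨ toℚᵘ-homo-* (m ÷ℕ suc c) (n ÷ℕ suc d) ⟩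
    toℚᵘ (m ÷ℕ suc c) ℚᵘ.* toℚᵘ (n ÷ℕ suc d)   ≈⟨ ℚᵘ.*-cong (toℚᵘ-÷ℕ m c) (toℚᵘ-÷ℕ n d) ⟩
    mkℚᵘ (+ m ℤ.* + n) _                       ≡⟨ cong (λ z → mkℚᵘ z _) (ℤ.pos-* m n) ⟨
    mkℚᵘ (+ (m ℕ.* n)) _                       ≈⟨ toℚᵘ-÷ℕ (m ℕ.* n) _ ⟨
    toℚᵘ ((m ℕ.* n) ÷ℕ (suc c ℕ.* suc d))      ∎)
    where open ℚᵘ.≃-Reasoning

  mkℚᵘ-≤ : ∀ m c n d → mkℚᵘ (+ m) c ℚᵘ.≤ mkℚᵘ (+ n) d ⇔ m ℕ.* suc d ℕ.≤ n ℕ.* suc c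
  mkℚᵘ-≤ m c n d = mk⇔
    (λ { (*≤* h) → ℤ.drop‿+≤+ (subst₂ ℤ._≤_ (sym (ℤ.pos-* m (suc d))) (sym (ℤ.pos-* n (suc c))) h) })
    (λ h → *≤* (subst₂ ℤ._≤_ (ℤ.pos-* m (suc d)) (ℤ.pos-* n (suc c)) (ℤ.+≤+ h)))

  ÷ℕ-≤ : ∀ m c n d → m ÷ℕ suc c ≤ n ÷ℕ suc d ⇔ m ℕ.* suc d ℕ.≤ n ℕ.* suc c
  ÷ℕ-≤ m c n d = mk⇔
    (λ h → Equivalence.to (mkℚᵘ-≤ m c n d)
      (ℚᵘ.≤-respˡ-≃ (toℚᵘ-÷ℕ m c) (ℚᵘ.≤-respʳ-≃ (toℚᵘ-÷ℕ n d) (toℚᵘ-mono-≤ h))))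
    (λ h → toℚᵘ-cancel-≤ (ℚᵘ.≤-respˡ-≃ (ℚᵘ.≃-sym (toℚᵘ-÷ℕ m c))
      (ℚᵘ.≤-respʳ-≃ (ℚᵘ.≃-sym (toℚᵘ-÷ℕ n d)) (Equivalence.from (mkℚᵘ-≤ m c n d) h))))

  fraction-gap : ∀ k q n₁ D₁ n₂ D₂ → 1 ℕ.≤ D₁ → 1 ℕ.≤ D₂ →
    n₁ ÷ℕ D₁ ≤ k ÷ℕ suc q + n₂ ÷ℕ D₂ ⇔ suc q ℕ.* n₁ ℕ.* D₂ ℕ.≤ suc q ℕ.* n₂ ℕ.* D₁ ℕ.+ k ℕ.* D₁ ℕ.* D₂
  fraction-gap k q n₁ D₁@(suc d₁) n₂ D₂@(suc d₂) _ _ = mk⇔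
    (λ h → subst₂ ℕ._≤_ (lhs n₁ Q D₂) (rhs k n₂ Q D₁ D₂)
      (Equivalence.to (÷ℕ-≤ n₁ d₁ N d) (subst (_ ≤_) (÷ℕ-+ k q n₂ d₂) h)))
    (λ h → subst (_ ≤_) (sym (÷ℕ-+ k q n₂ d₂))
      (Equivalence.from (÷ℕ-≤ n₁ d₁ N d) (subst₂ ℕ._≤_ (sym (lhs n₁ Q D₂)) (sym (rhs k n₂ Q D₁ D₂)) h)))
    where
    Q = suc q
    N = k ℕ.* D₂ ℕ.+ n₂ ℕ.* Q
    d = d₂ ℕ.+ q ℕ.* D₂
    lhs : ∀ n Q D → n ℕ.* (Q ℕ.* D) ≡ Q ℕ.* n ℕ.* D
    lhs = solve-∀
    rhs : ∀ k n Q D₁ D₂ → (k ℕ.* D₂ ℕ.+ n ℕ.* Q) ℕ.* D₁ ≡ Q ℕ.* n ℕ.* D₁ ℕ.+ k ℕ.* D₁ ℕ.* D₂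
    rhs = solve-∀

  mkℚ-as-÷ℕ : ∀ p q .(c : Coprime p (suc q)) → mkℚ (+ p) q c ≡ p ÷ℕ suc q
  mkℚ-as-÷ℕ p q c = sym (↥p/↧p≡p (mkℚ (+ p) q c))

  four-times : ∀ p q → (+ 4) / 1 * p ÷ℕ suc q ≡ (4 ℕ.* p) ÷ℕ suc q
  four-times p q = trans (÷ℕ-* 4 0 p q) (cong ((4 ℕ.* p) ÷ℕ_) (ℕ.*-identityˡ (suc q)))

  numerator<denominator : ∀ p q .(c : Coprime p (suc q)) → mkℚ (+ p) q c < (+ 1) / 4 → p ℕ.< suc q
  numerator<denominator p q _ (*<* h) =
    ℕ.≤-<-trans (ℕ.m≤m*n p 4) (subst (p ℕ.* 4 ℕ.<_) (ℕ.*-identityˡ (suc q))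
      (ℤ.drop‿+<+ (subst₂ ℤ._<_ (sym (ℤ.pos-* p 4)) (sym (ℤ.pos-* 1 (suc q))) h)))

  ratio-hypothesis : ∀ p q n D → 1 ℕ.≤ D → n ÷ℕ D ≥ 1ℚ - p ÷ℕ suc q →
    suc q ℕ.* D ℕ.≤ suc q ℕ.* n ℕ.+ p ℕ.* D
  ratio-hypothesis p q n D 1≤D h = subst₂ ℕ._≤_ (lhs (suc q) D) (rhs (suc q) n p D)
    (Equivalence.to (fraction-gap p q 1 1 n D (ℕ.s≤s ℕ.z≤n) 1≤D)
      (subst₂ _≤_ (//-rightDividesˡ δ 1ℚ) (+-comm _ δ) (+-monoˡ-≤ δ h)))
    where
    δ = p ÷ℕ suc q
    lhs : ∀ Q D → Q ℕ.* 1 ℕ.* D ≡ Q ℕ.* D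
    lhs = solve-∀
    rhs : ∀ Q n p D → Q ℕ.* n ℕ.* 1 ℕ.+ p ℕ.* 1 ℕ.* D ≡ Q ℕ.* n ℕ.+ p ℕ.* D
    rhs = solve-∀

  difference-≤ : ∀ {u v c} → u ≤ c + v → u - v ≤ c
  difference-≤ {u} {v} {c} h = subst (u - v ≤_) (//-rightDividesʳ v c) (+-monoˡ-≤ (- v) h)

  ∣-∣≤-from-both-sides : ∀ {x y c} → x ≤ c + y → y ≤ c + x → ∣ x - y ∣ ≤ c
  ∣-∣≤-from-both-sides {x} {y} {c} x≤c+y y≤c+x with ∣p∣≡p∨∣p∣≡-p (x - y)
  ... | inj₁ ∣x-y∣≡x-y  = subst (_≤ c) (sym ∣x-y∣≡x-y) (difference-≤ x≤c+y)
  ... | inj₂ ∣x-y∣≡y-x = subst (_≤ c) (sym (trans ∣x-y∣≡y-x (⁻¹-anti-homo‿- x y))) (difference-≤ y≤c+x)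


module Stability where

  open Deficiency
  open NaturalFractions
  open import Data.Nat using (suc; _+_; _*_; _≤_; _<_)
  open import Data.Nat.Properties using (*-mono-≤; *-monoʳ-≤; *-identityʳ; ≤-trans)
  open import Data.Integer using (+_; -[1+_])
  open import Data.Rational using (ℚ; mkℚ; _/_; _≥_; _-_; ∣_∣; 0ℚ; 1ℚ; *<*)
  import Data.Rational as ℚ
  open import Function.Bundles using (Equivalence)
  open import Relation.Binary.PropositionalEquality using (_≡_; refl; sym; subst)

  stability : ∀ {δ p q a a′ V V′ W W′} → δ ≡ p ÷ℕ suc q → p < suc q → 1 ≤ V → 1 ≤ W →
    a′ ≤ a → a′ ≤ V′ → V′ ≤ V → W′ ≤ W → a + V′ + W′ ≤ a′ + V + W →
    V′ ÷ℕ V ≥ 1ℚ - δ → W′ ÷ℕ W ≥ 1ℚ - δ →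
    ∣ a ÷ℕ (V * W) - a′ ÷ℕ (V′ * W′) ∣ ℚ.≤ (+ 4) / 1 ℚ.* δ
  stability {p = p} {q} {a} {a′} {V} {V′} {W} {W′} refl p<Q 1≤V 1≤W a′≤a a′≤V′ V′≤V W′≤W ie hV hW =
    subst (_ ℚ.≤_) (sym (four-times p q)) (∣-∣≤-from-both-sides
      (Equivalence.from (fraction-gap (4 * p) q a B a′ E 1≤B 1≤E)
        (slack-2≤4 {p = p} {B} {E} (upper-bound {Q} {p}
          (*-mono-≤ V′≤V W′≤W) (sum≤2*product 1≤V 1≤W)
          (deficiency-bound {Q} {p} ie defV defW))))
      (Equivalence.from (fraction-gap (4 * p) q a′ E a B 1≤E 1≤B)
        (slack-2≤4 {p = p} {E} {B} (lower-bound {Q} {p} a′≤a a′≤E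
          (product-deficiency {Q} {p} V′≤V defV defW)))))
    where
    Q = suc q
    B = V * W
    E = V′ * W′
    defV : Q * V ≤ Q * V′ + p * V
    defV = ratio-hypothesis p q V′ V 1≤V hV
    defW : Q * W ≤ Q * W′ + p * W
    defW = ratio-hypothesis p q W′ W 1≤W hW
    1≤W′ : 1 ≤ W′
    1≤W′ = positive-part p<Q 1≤W defW
    1≤B : 1 ≤ B
    1≤B = *-mono-≤ 1≤V 1≤W
    1≤E : 1 ≤ E
    1≤E = *-mono-≤ (positive-part p<Q 1≤V defV) 1≤W′
    a′≤E : a′ ≤ E
    a′≤E = ≤-trans a′≤V′ (subst (_≤ E) (*-identityʳ V′) (*-monoʳ-≤ V′ 1≤W′))

  -- The same for an arbitrary rational δ: 0 < δ excludes a negative numerator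
  -- and δ < 1/4 gives p < Q.
  density-stability : ∀ (δ : ℚ) → 0ℚ ℚ.< δ → δ ℚ.< (+ 1) / 4 → ∀ {a a′ V V′ W W′} →
    1 ≤ V → 1 ≤ W → a′ ≤ a → a′ ≤ V′ → V′ ≤ V → W′ ≤ W → a + V′ + W′ ≤ a′ + V + W →
    V′ ÷ℕ V ≥ 1ℚ - δ → W′ ÷ℕ W ≥ 1ℚ - δ →
    ∣ a ÷ℕ (V * W) - a′ ÷ℕ (V′ * W′) ∣ ℚ.≤ (+ 4) / 1 ℚ.* δ
  density-stability (mkℚ -[1+ _ ] _ _) (*<* ())
  density-stability (mkℚ (+ p) q c) _ δ<¼ =
    stability (mkℚ-as-÷ℕ p q c) (numerator<denominator p q c δ<¼)

open import Defs using (VR; VC; d)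
open import Data.Bool using (true)
open import Data.Fin using (Fin)
open import Data.Fin.Subset using (Subset; _⊆_; Nonempty)
open import Data.Product using (∃)
open import Relation.Binary.PropositionalEquality using (_≡_)
open import Data.Integer using (+_)
open import Data.Rational using (ℚ; _/_; _<_; _≤_; _≥_; _-_; _*_; ∣_∣; 0ℚ; 1ℚ)
open Stability using (density-stability)

mainTheorem1 : {m n : ℕ} (A : Array m n)
    → (∀ (i : Fin m) → ∃ λ (j : Fin n) → A i j ≡ true)
    → (∀ (j : Fin n) → ∃ λ (i : Fin m) → A i j ≡ true)
    → (δ : ℚ) → 0ℚ < δ → δ < (+ 1) / 4
    → (X Xs : Subset m) (Y Ys : Subset n)
    → Nonempty X → Nonempty Y
    → Xs ⊆ X → Ys ⊆ Y
    → (VR A Xs ÷ℕ VR A X) ≥ 1ℚ - δ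
    → (VC A Ys ÷ℕ VC A Y) ≥ 1ℚ - δ
    → ∣ d A X Y - d A Xs Ys ∣ ≤ (+ 4) / 1 * δ
mainTheorem1 A rows cols δ 0<δ δ<¼ X Xs Y Ys X≠∅ Y≠∅ Xs⊆X Ys⊆Y hX hY =
  density-stability δ 0<δ δ<¼
    (VR-positive rows X≠∅) (VC-positive cols Y≠∅)
    (a-mono Xs⊆X Ys⊆Y) (a≤VR Xs Ys) (VR-mono Xs⊆X) (VC-mono Ys⊆Y)
    (inclusion-exclusion Xs⊆X Ys⊆Y) hX hY
  where open ArrayCounts A
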